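{- If $|J|=3p-2$ or $|J|=3p-1$, then $1-(p, J)+(2p, J)\equiv 0 \pmod p$.
   Context: Let $p$ be an odd prime and let $J$ be a finite set of lattice points in the Euclidean plane. For a positive integer $n$ and a finite set $X$ of lattice points, $(n, X)$ denotes the number of $n$-element subsets of $X$ the sum of whose elements (taken coordinatewise) is divisible by $p$, i.e. is $\equiv (0,0) \pmod p$. -}

module Defs where

open import Data.Nat using (ℕ; zero; suc)
open import Data.Integer using (ℤ; +_; _+_; _-_)
open import Data.Product using (_×_; _,_)
open import Data.List using (List; []; _∷_; _++_; map; length)
open import Relation.Nullary using (Dec; yes; no)
open import Relation.Nullary.Decidable using (⌊_⌋)
open import Data.Bool using (Bool; true; false; if_then_else_; _∧_)
import Data.Nat as ℕ
import Data.Integer.Divisibility.Signed as S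

Point : Set
Point = ℤ × ℤ

sumPts : List Point → Point
sumPts [] = (+ 0 , + 0)
sumPts ((a , b) ∷ xs) with sumPts xs
... | (c , d) = (a + c , b + d)

-- All sublists (subsequences) of a list; for a list without duplicates these
-- are in bijection with the subsets of the underlying finite set.
sublists : {A : Set} → List A → List (List A)
sublists [] = [] ∷ []
sublists (x ∷ xs) = sublists xs ++ map (x ∷_) (sublists xs)

divPt : (p : ℕ) → Point → Bool
divPt p (a , b) = ⌊ S._∣?_ (+ p) a ⌋ ∧ ⌊ S._∣?_ (+ p) b ⌋

count : {A : Set} → (A → Bool) → List A → ℕ
count P [] = 0
count P (x ∷ xs) = if P x then suc (count P xs) else count P xs

-- (n, X) for prime modulus p: number of n-element subsets of X
-- (X given as a duplicate-free list) whose coordinatewise sum is ≡ (0,0) mod p.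
nsub : (p n : ℕ) → List Point → ℕ
nsub p n X = count (λ S → ⌊ length S ℕ.≟ n ⌋ ∧ divPt p (sumPts S)) (sublists X)

{-# OPTIONS --safe #-}
module Submission where

-- With F t = ∏_{j=1}^{p-1} (j - t) one has F t ≡ F 0 · [p ∣ t] (mod p) and p ∤ F 0, so up to the unit
-- (F 0)³ the function G (n , a , b) = F n · F a · F b is the indicator of p ∣ n, a, b.  It has degree
-- 3(p - 1) < |J|, and S ↦ (|S| , ΣS) is additive, so the alternating sum Σ_{S ⊆ J} (-1)^|S| G (|S| , ΣS)
-- vanishes: each element of J turns it into (minus) the alternating sum of a finite difference of G,
-- which has lower degree.  Reducing mod p, since |S| < 3p only the S with |S| ∈ {0, p, 2p} contribute,
-- with signs +, -, + as p is odd, and the sum becomes (F 0)³ (1 - (p, J) + (2p, J)).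

open import Defs

module PolynomialMethod where

  import Data.Integer.Properties as ℤₚ
  import Data.Nat.Properties as ℕₚ
  open import Data.Bool using (Bool; true; false; if_then_else_; _∧_)
  open import Data.Empty using (⊥-elim)
  open import Data.Integer as ℤ using (ℤ; +_; _+_; _-_; _*_; -_)
  open import Data.Integer.DivMod using (_%ℕ_; _/ℕ_; a≡a%ℕn+[a/ℕn]*n; n%ℕd<d)
  open import Data.Integer.Divisibility.Signed
    using (_∣_; _∣?_; divides; ∣⇒∣ᵤ; ∣ᵤ⇒∣; ∣m∣n⇒∣m+n; ∣m⇒∣-m; ∣m⇒∣m*n; ∣n⇒∣m*n)
  open import Data.Integer.Tactic.RingSolver using (solve-∀)
  open import Data.List using (List; []; _∷_; _++_; map; length; applyUpTo)
  open import Data.List.Properties using (length-applyUpTo)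
  open import Data.List.Relation.Unary.Any using (Any; here; there)
  open import Data.List.Relation.Unary.Any.Properties using (applyUpTo⁺; applyUpTo⁻)
  open import Data.Nat as ℕ using (ℕ; zero; suc; _≤_; _<_; s≤s; z≤n; NonZero)
  open import Data.Nat.Divisibility as ℕ using () renaming (_∣_ to _ℕ∣_)
  open import Data.Nat.Primality using (Prime; euclidsLemma; prime⇒nonZero; prime⇒irreducible; ¬prime[1])
  open import Data.Nat.Properties using (suc[m]≤n⇒m≤pred[n]; m≤pred[n]⇒suc[m]≤n)
  open import Data.Nat.Tactic.RingSolver using () renaming (solve-∀ to ℕ-solve-∀)
  open import Data.Product using (_×_; _,_; proj₁; proj₂; ∃-syntax)
  open import Data.Sum as Sum using (_⊎_; inj₁; inj₂)
  open import Function using (id)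
  open import Level using (0ℓ)
  open import Relation.Binary.Bundles using (Setoid)
  open import Relation.Binary.PropositionalEquality
  import Relation.Binary.Reasoning.Setoid as SetoidReasoning
  open import Relation.Nullary using (¬_; yes; no)
  open import Relation.Nullary.Decidable using (⌊_⌋)
  open import Algebra.Properties.CommutativeSemigroup ℤₚ.+-commutativeSemigroup using ()
    renaming (interchange to +-interchange)

  infix 4 _≡_[mod_]

  -- A record rather than a synonym for m ∣ x - y, so that x and y stay inferable from a congruence.
  record _≡_[mod_] (x y m : ℤ) : Set where
    constructor mod-intro
    field
      mod-elim : m ∣ x - y

  open _≡_[mod_]

  module _ {m : ℤ} where

    ≡⇒≡-mod : ∀ {x y} → x ≡ y → x ≡ y [mod m ]
    ≡⇒≡-mod {x} refl = mod-intro (divides (+ 0) (ℤₚ.+-inverseʳ x))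

    mod-sym : ∀ {x y} → x ≡ y [mod m ] → y ≡ x [mod m ]
    mod-sym {x} {y} x≡y = mod-intro (subst (m ∣_) (eq x y) (∣m⇒∣-m (mod-elim x≡y)))
      where
      eq : ∀ x y → - (x - y) ≡ y - x
      eq = solve-∀

    mod-trans : ∀ {x y z} → x ≡ y [mod m ] → y ≡ z [mod m ] → x ≡ z [mod m ]
    mod-trans {x} {y} {z} x≡y y≡z =
      mod-intro (subst (m ∣_) (eq x y z) (∣m∣n⇒∣m+n (mod-elim x≡y) (mod-elim y≡z)))
      where
      eq : ∀ x y z → (x - y) + (y - z) ≡ x - z
      eq = solve-∀

    +-cong-mod : ∀ {a a′ b b′} → a ≡ a′ [mod m ] → b ≡ b′ [mod m ] → a + b ≡ a′ + b′ [mod m ]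
    +-cong-mod {a} {a′} {b} {b′} a≡a′ b≡b′ =
      mod-intro (subst (m ∣_) (eq a a′ b b′) (∣m∣n⇒∣m+n (mod-elim a≡a′) (mod-elim b≡b′)))
      where
      eq : ∀ a a′ b b′ → (a - a′) + (b - b′) ≡ (a + b) - (a′ + b′)
      eq = solve-∀

    neg-cong-mod : ∀ {a a′} → a ≡ a′ [mod m ] → - a ≡ - a′ [mod m ]
    neg-cong-mod {a} {a′} a≡a′ = mod-intro (subst (m ∣_) (eq a a′) (∣m⇒∣-m (mod-elim a≡a′)))
      where
      eq : ∀ a a′ → - (a - a′) ≡ - a - - a′
      eq = solve-∀

    *-cong-mod : ∀ {a a′ b b′} → a ≡ a′ [mod m ] → b ≡ b′ [mod m ] → a * b ≡ a′ * b′ [mod m ]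
    *-cong-mod {a} {a′} {b} {b′} a≡a′ b≡b′ = mod-intro
      (subst (m ∣_) (eq a a′ b b′)
        (∣m∣n⇒∣m+n (∣m⇒∣m*n b (mod-elim a≡a′)) (∣n⇒∣m*n a′ (mod-elim b≡b′))))
      where
      eq : ∀ a a′ b b′ → (a - a′) * b + a′ * (b - b′) ≡ a * b - a′ * b′
      eq = solve-∀

  ∣⇒≡0-mod : ∀ {m x} → m ∣ x → x ≡ + 0 [mod m ]
  ∣⇒≡0-mod {m} {x} m∣x = mod-intro (subst (m ∣_) (sym (ℤₚ.+-identityʳ x)) m∣x)

  ≡0-mod⇒∣ : ∀ {m x} → x ≡ + 0 [mod m ] → m ∣ x
  ≡0-mod⇒∣ {m} {x} (mod-intro m∣x) = subst (m ∣_) (ℤₚ.+-identityʳ x) m∣x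

  mod-setoid : ℤ → Setoid 0ℓ 0ℓ
  mod-setoid m = record
    { Carrier = ℤ
    ; _≈_ = _≡_[mod m ]
    ; isEquivalence = record { refl = ≡⇒≡-mod refl ; sym = mod-sym ; trans = mod-trans }
    }

  indicator : Bool → ℤ
  indicator b = if b then + 1 else + 0

  indicator-∧ : ∀ a b → indicator (a ∧ b) ≡ indicator a * indicator b
  indicator-∧ true true = refl
  indicator-∧ true false = refl
  indicator-∧ false b = refl

  δ : ℕ → ℕ → ℤ
  δ n k = indicator ⌊ n ℕ.≟ k ⌋

  δ-refl : ∀ n → δ n n ≡ + 1
  δ-refl n with n ℕ.≟ n
  ... | yes _ = refl
  ... | no n≢n = ⊥-elim (n≢n refl)

  δ-≢ : ∀ n k → n ≢ k → δ n k ≡ + 0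
  δ-≢ n k n≢k with n ℕ.≟ k
  ... | yes n≡k = ⊥-elim (n≢k n≡k)
  ... | no _ = refl

  polyWithRoots : List ℤ → ℤ → ℤ
  polyWithRoots [] t = + 1
  polyWithRoots (j ∷ js) t = polyWithRoots js t * (j - t)

  polyWithRoots-cong-mod : ∀ {m} js {t t′} → t ≡ t′ [mod m ] → polyWithRoots js t ≡ polyWithRoots js t′ [mod m ]
  polyWithRoots-cong-mod [] t≡t′ = ≡⇒≡-mod refl
  polyWithRoots-cong-mod (j ∷ js) t≡t′ =
    *-cong-mod (polyWithRoots-cong-mod js t≡t′) (+-cong-mod (≡⇒≡-mod {x = j} refl) (neg-cong-mod t≡t′))

  Any⇒∣-polyWithRoots : ∀ {m} js t → Any (λ j → m ∣ j - t) js → m ∣ polyWithRoots js t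
  Any⇒∣-polyWithRoots (j ∷ js) t (here m∣j-t) = ∣n⇒∣m*n (polyWithRoots js t) m∣j-t
  Any⇒∣-polyWithRoots (j ∷ js) t (there m∣js) = ∣m⇒∣m*n (j - t) (Any⇒∣-polyWithRoots js t m∣js)

  count-++ : ∀ {X : Set} (Q : X → Bool) xs ys → count Q (xs ++ ys) ≡ count Q xs ℕ.+ count Q ys
  count-++ Q [] ys = refl
  count-++ Q (x ∷ xs) ys with Q x
  ... | true = cong suc (count-++ Q xs ys)
  ... | false = count-++ Q xs ys

  count-map : ∀ {X Y : Set} (Q : Y → Bool) (f : X → Y) xs → count Q (map f xs) ≡ count (λ x → Q (f x)) xs
  count-map Q f [] = refl
  count-map Q f (x ∷ xs) with Q (f x)
  ... | true = cong suc (count-map Q f xs)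
  ... | false = count-map Q f xs

  count-false : ∀ {X : Set} (xs : List X) → count (λ _ → false) xs ≡ 0
  count-false [] = refl
  count-false (x ∷ xs) = count-false xs

  nsub-zero : ∀ p xs → nsub p 0 xs ≡ 1
  nsub-zero p [] with + p ∣? + 0
  ... | yes _ = refl
  ... | no p∤0 = ⊥-elim (p∤0 (divides (+ 0) refl))
  nsub-zero p (x ∷ xs) = begin
      count Q (sublists xs ++ map (x ∷_) (sublists xs))
    ≡⟨ count-++ Q (sublists xs) _ ⟩
      count Q (sublists xs) ℕ.+ count Q (map (x ∷_) (sublists xs))
    ≡⟨ cong₂ ℕ._+_ (nsub-zero p xs) (trans (count-map Q (x ∷_) (sublists xs)) (count-false (sublists xs))) ⟩
      1 ∎
    where
    open ≡-Reasoning
    Q : List Point → Bool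
    Q S = ⌊ length S ℕ.≟ 0 ⌋ ∧ divPt p (sumPts S)

  module _ {X : Set} where

    sumSublists : List X → (List X → ℤ) → ℤ
    sumSublists [] f = f []
    sumSublists (x ∷ xs) f = sumSublists xs f + sumSublists xs (λ S → f (x ∷ S))

    sumSublists-cong : ∀ xs {f g : List X → ℤ} → (∀ S → f S ≡ g S) → sumSublists xs f ≡ sumSublists xs g
    sumSublists-cong [] f≡g = f≡g []
    sumSublists-cong (x ∷ xs) f≡g =
      cong₂ _+_ (sumSublists-cong xs f≡g) (sumSublists-cong xs (λ S → f≡g (x ∷ S)))

    sumSublists-zero : ∀ xs → sumSublists xs (λ _ → + 0) ≡ + 0
    sumSublists-zero [] = refl
    sumSublists-zero (x ∷ xs) rewrite sumSublists-zero xs = refl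

    sumSublists-+ : ∀ xs (f g : List X → ℤ) →
      sumSublists xs (λ S → f S + g S) ≡ sumSublists xs f + sumSublists xs g
    sumSublists-+ [] f g = refl
    sumSublists-+ (x ∷ xs) f g
      rewrite sumSublists-+ xs f g | sumSublists-+ xs (λ S → f (x ∷ S)) (λ S → g (x ∷ S)) =
      +-interchange (sumSublists xs f) (sumSublists xs g) _ _

    sumSublists-neg : ∀ xs (f : List X → ℤ) → sumSublists xs (λ S → - f S) ≡ - sumSublists xs f
    sumSublists-neg [] f = refl
    sumSublists-neg (x ∷ xs) f rewrite sumSublists-neg xs f | sumSublists-neg xs (λ S → f (x ∷ S)) =
      sym (ℤₚ.neg-distrib-+ (sumSublists xs f) (sumSublists xs (λ S → f (x ∷ S))))

    sumSublists-*ˡ : ∀ xs k (f : List X → ℤ) → sumSublists xs (λ S → k * f S) ≡ k * sumSublists xs f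
    sumSublists-*ˡ [] k f = refl
    sumSublists-*ˡ (x ∷ xs) k f rewrite sumSublists-*ˡ xs k f | sumSublists-*ˡ xs k (λ S → f (x ∷ S)) =
      sym (ℤₚ.*-distribˡ-+ k _ _)

    sumSublists-cong-mod : ∀ {m} xs {f g : List X → ℤ} → (∀ S → length S ≤ length xs → f S ≡ g S [mod m ]) →
      sumSublists xs f ≡ sumSublists xs g [mod m ]
    sumSublists-cong-mod [] f≡g = f≡g [] z≤n
    sumSublists-cong-mod (x ∷ xs) f≡g = +-cong-mod
      (sumSublists-cong-mod xs (λ S ∣S∣≤ → f≡g S (ℕₚ.m≤n⇒m≤1+n ∣S∣≤)))
      (sumSublists-cong-mod xs (λ S ∣S∣≤ → f≡g (x ∷ S) (s≤s ∣S∣≤)))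

    sumSublists-count : ∀ (Q : List X → Bool) xs → sumSublists xs (λ S → indicator (Q S)) ≡ + count Q (sublists xs)
    sumSublists-count Q [] with Q []
    ... | true = refl
    ... | false = refl
    sumSublists-count Q (x ∷ xs) = begin
        sumSublists xs (λ S → indicator (Q S)) + sumSublists xs (λ S → indicator (Q (x ∷ S)))
      ≡⟨ cong₂ _+_ (sumSublists-count Q xs) (sumSublists-count (λ S → Q (x ∷ S)) xs) ⟩
        + count Q (sublists xs) + + count (λ S → Q (x ∷ S)) (sublists xs)
      ≡⟨ cong (λ c → + count Q (sublists xs) + + c) (sym (count-map Q (x ∷_) (sublists xs))) ⟩
        + count Q (sublists xs) + + count Q (map (x ∷_) (sublists xs))
      ≡⟨ sym (trans (cong +_ (count-++ Q (sublists xs) _)) (ℤₚ.pos-+ (count Q (sublists xs)) _)) ⟩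
        + count Q (sublists (x ∷ xs)) ∎
      where
      open ≡-Reasoning

  sign : ℕ → ℤ
  sign zero = + 1
  sign (suc n) = - sign n

  sign-double : ∀ m → sign (m ℕ.+ m) ≡ + 1
  sign-double zero = refl
  sign-double (suc m) rewrite ℕₚ.+-suc m m = trans (ℤₚ.neg-involutive (sign (m ℕ.+ m))) (sign-double m)

  even⊎odd : ∀ n → ∃[ m ] n ≡ m ℕ.+ m ⊎ ∃[ m ] n ≡ suc (m ℕ.+ m)
  even⊎odd zero = inj₁ (0 , refl)
  even⊎odd (suc n) with even⊎odd n
  ... | inj₁ (m , n≡m+m) = inj₂ (m , cong suc n≡m+m)
  ... | inj₂ (m , n≡1+m+m) = inj₁ (suc m , trans (cong suc n≡1+m+m) (cong suc (sym (ℕₚ.+-suc m m))))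

  module FiniteDifferences {A : Set} (_⊕_ : A → A → A) where

    Δ : A → (A → ℤ) → A → ℤ
    Δ v g u = g (v ⊕ u) - g u

    DegreeBelow : ℕ → (A → ℤ) → Set
    DegreeBelow zero g = ∀ u → g u ≡ + 0
    DegreeBelow (suc d) g = ∀ v → DegreeBelow d (Δ v g)

    Additive : (A → ℤ) → Set
    Additive ℓ = ∀ u w → ℓ (u ⊕ w) ≡ ℓ u + ℓ w

    DegreeBelow-cong : ∀ d {f g} → (∀ u → f u ≡ g u) → DegreeBelow d f → DegreeBelow d g
    DegreeBelow-cong zero f≡g Df u = trans (sym (f≡g u)) (Df u)
    DegreeBelow-cong (suc d) f≡g Df v = DegreeBelow-cong d (λ u → cong₂ _-_ (f≡g (v ⊕ u)) (f≡g u)) (Df v)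

    DegreeBelow-+ : ∀ d {f g} → DegreeBelow d f → DegreeBelow d g → DegreeBelow d (λ u → f u + g u)
    DegreeBelow-+ zero Df Dg u = cong₂ _+_ (Df u) (Dg u)
    DegreeBelow-+ (suc d) {f} {g} Df Dg v =
      DegreeBelow-cong d (λ u → eq (f (v ⊕ u)) (g (v ⊕ u)) (f u) (g u)) (DegreeBelow-+ d (Df v) (Dg v))
      where
      eq : ∀ a b c e → (a - c) + (b - e) ≡ (a + b) - (c + e)
      eq = solve-∀

    DegreeBelow-*ʳ : ∀ d {f} k → DegreeBelow d f → DegreeBelow d (λ u → f u * k)
    DegreeBelow-*ʳ zero k Df u = cong (_* k) (Df u)
    DegreeBelow-*ʳ (suc d) {f} k Df v =
      DegreeBelow-cong d (λ u → eq (f (v ⊕ u)) (f u) k) (DegreeBelow-*ʳ d k (Df v))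
      where
      eq : ∀ a c k → (a - c) * k ≡ a * k - c * k
      eq = solve-∀

    Δ-*-affine : ∀ {ℓ} f c → Additive ℓ → ∀ v u →
      Δ v (λ u → f u * (c - ℓ u)) u ≡ Δ v f u * ((c - ℓ v) - ℓ u) + f u * (- ℓ v)
    Δ-*-affine {ℓ} f c ℓ-additive v u rewrite ℓ-additive v u = eq (f (v ⊕ u)) (f u) c (ℓ v) (ℓ u)
      where
      eq : ∀ a b c x y → a * (c - (x + y)) - b * (c - y) ≡ (a - b) * ((c - x) - y) + b * (- x)
      eq = solve-∀

    DegreeBelow-*-affine : ∀ d {f} c ℓ → Additive ℓ → DegreeBelow d f → DegreeBelow (suc d) (λ u → f u * (c - ℓ u))
    DegreeBelow-*-affine zero {f} c ℓ ℓ-additive Df v u = trans (Δ-*-affine f c ℓ-additive v u)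
      (cong₂ (λ a b → (a - b) * ((c - ℓ v) - ℓ u) + b * (- ℓ v)) (Df (v ⊕ u)) (Df u))
    DegreeBelow-*-affine (suc d) {f} c ℓ ℓ-additive Df v =
      DegreeBelow-cong (suc d) (λ u → sym (Δ-*-affine f c ℓ-additive v u))
        (DegreeBelow-+ (suc d) {λ u → Δ v f u * ((c - ℓ v) - ℓ u)} {λ u → f u * (- ℓ v)}
          (DegreeBelow-*-affine d (c - ℓ v) ℓ ℓ-additive (Df v)) (DegreeBelow-*ʳ (suc d) {f} (- ℓ v) Df))

    DegreeBelow-*-polyWithRoots : ∀ js d {f} ℓ → Additive ℓ → DegreeBelow d f →
      DegreeBelow (length js ℕ.+ d) (λ u → f u * polyWithRoots js (ℓ u))
    DegreeBelow-*-polyWithRoots [] d {f} ℓ ℓ-additive Df = DegreeBelow-cong d (λ u → sym (ℤₚ.*-identityʳ (f u))) Df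
    DegreeBelow-*-polyWithRoots (j ∷ js) d {f} ℓ ℓ-additive Df =
      DegreeBelow-cong (suc (length js ℕ.+ d)) (λ u → ℤₚ.*-assoc (f u) (polyWithRoots js (ℓ u)) (j - ℓ u))
        (DegreeBelow-*-affine (length js ℕ.+ d) j ℓ ℓ-additive (DegreeBelow-*-polyWithRoots js d ℓ ℓ-additive Df))

    module _ {X : Set} (v : X → A) {σ : List X → A} (σ-∷ : ∀ x S → σ (x ∷ S) ≡ v x ⊕ σ S) where

      alternatingSum : (A → ℤ) → List X → ℤ
      alternatingSum g xs = sumSublists xs (λ S → sign (length S) * g (σ S))

      alternatingSum-∷ : ∀ g x xs → alternatingSum g (x ∷ xs) ≡ - alternatingSum (Δ (v x) g) xs
      alternatingSum-∷ g x xs = begin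
          sumSublists xs F + sumSublists xs (λ S → - sign (length S) * g (σ (x ∷ S)))
        ≡⟨ sym (sumSublists-+ xs F _) ⟩
          sumSublists xs (λ S → F S + - sign (length S) * g (σ (x ∷ S)))
        ≡⟨ sumSublists-cong xs (λ S → cong (λ w → F S + - sign (length S) * g w) (σ-∷ x S)) ⟩
          sumSublists xs (λ S → F S + - sign (length S) * g (v x ⊕ σ S))
        ≡⟨ sumSublists-cong xs (λ S → eq (sign (length S)) (g (σ S)) (g (v x ⊕ σ S))) ⟩
          sumSublists xs (λ S → - (sign (length S) * Δ (v x) g (σ S)))
        ≡⟨ sumSublists-neg xs _ ⟩
          - alternatingSum (Δ (v x) g) xs ∎
        where
        open ≡-Reasoning
        F : List X → ℤ
        F S = sign (length S) * g (σ S)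
        eq : ∀ s a b → s * a + - s * b ≡ - (s * (b - a))
        eq = solve-∀

      alternatingSum-vanishes : ∀ d xs {g} → DegreeBelow d g → d ≤ length xs → alternatingSum g xs ≡ + 0
      alternatingSum-vanishes zero xs {g} Dg _ =
        trans (sumSublists-cong xs (λ S → trans (cong (sign (length S) *_) (Dg (σ S))) (ℤₚ.*-zeroʳ (sign (length S)))))
              (sumSublists-zero xs)
      alternatingSum-vanishes (suc d) (x ∷ xs) {g} Dg (s≤s d≤∣xs∣) =
        trans (alternatingSum-∷ g x xs) (cong -_ (alternatingSum-vanishes d xs (Dg (v x)) d≤∣xs∣))

  _⊕_ : ℤ × Point → ℤ × Point → ℤ × Point
  (n , (a , b)) ⊕ (n′ , (a′ , b′)) = (n + n′ , (a + a′ , b + b′))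

  σ : List Point → ℤ × Point
  σ S = (+ length S , sumPts S)

  σ-∷ : ∀ x S → σ (x ∷ S) ≡ (+ 1 , x) ⊕ σ S
  σ-∷ x S = refl

  module ModuloPrime (p : ℕ) (p-prime : Prime p) where

    private instance
      p-nonZero : NonZero p
      p-nonZero = prime⇒nonZero p-prime

    P : ℤ
    P = + p

    P∣*⇒ : ∀ a b → P ∣ a * b → P ∣ a ⊎ P ∣ b
    P∣*⇒ a b P∣ab = Sum.map ∣ᵤ⇒∣ ∣ᵤ⇒∣
      (euclidsLemma ℤ.∣ a ∣ ℤ.∣ b ∣ p-prime (subst (p ℕ∣_) (ℤₚ.abs-* a b) (∣⇒∣ᵤ P∣ab)))

    P∣*-cancelˡ : ∀ {a b} → ¬ P ∣ a → P ∣ a * b → P ∣ b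
    P∣*-cancelˡ {a} {b} P∤a P∣ab = Sum.[ (λ P∣a → ⊥-elim (P∤a P∣a)) , id ] (P∣*⇒ a b P∣ab)

    P∤1 : ¬ P ∣ + 1
    P∤1 P∣1 = ¬prime[1] (subst Prime (ℕ.∣1⇒≡1 (∣⇒∣ᵤ P∣1)) p-prime)

    P∣polyWithRoots⇒Any : ∀ js t → P ∣ polyWithRoots js t → Any (λ j → P ∣ j - t) js
    P∣polyWithRoots⇒Any [] t P∣1 = ⊥-elim (P∤1 P∣1)
    P∣polyWithRoots⇒Any (j ∷ js) t P∣∏ with P∣*⇒ (polyWithRoots js t) (j - t) P∣∏
    ... | inj₁ P∣∏js = there (P∣polyWithRoots⇒Any js t P∣∏js)
    ... | inj₂ P∣j-t = here P∣j-t

    nonzeroResidues : List ℤ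
    nonzeroResidues = applyUpTo (λ i → + suc i) (ℕ.pred p)

    P∤⇒Any-nonzeroResidue : ∀ t → ¬ P ∣ t → Any (λ j → P ∣ j - t) nonzeroResidues
    P∤⇒Any-nonzeroResidue t P∤t with t %ℕ p in t%p≡r | n%ℕd<d t p
    ... | zero | _ = ⊥-elim (P∤t (divides (t /ℕ p) t≡qP))
      where
      t≡qP : t ≡ t /ℕ p * P
      t≡qP = trans (a≡a%ℕn+[a/ℕn]*n t p) (trans (cong (λ r → + r + t /ℕ p * P) t%p≡r) (ℤₚ.+-identityˡ _))
    ... | suc r | r<p = applyUpTo⁺ (λ i → + suc i) (divides (- (t /ℕ p)) r-t≡-qP) (suc[m]≤n⇒m≤pred[n] r<p)
      where
      eq : ∀ r q m → r - (r + q * m) ≡ - q * m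
      eq = solve-∀
      r-t≡-qP : + suc r - t ≡ - (t /ℕ p) * P
      r-t≡-qP = trans
        (cong (λ u → + suc r - u) (trans (a≡a%ℕn+[a/ℕn]*n t p) (cong (λ r → + r + t /ℕ p * P) t%p≡r)))
        (eq (+ suc r) (t /ℕ p) P)

    ¬Any-nonzeroResidue-P∣ : ¬ Any (λ j → P ∣ j - + 0) nonzeroResidues
    ¬Any-nonzeroResidue-P∣ P∣j with applyUpTo⁻ (λ i → + suc i) P∣j
    ... | i , i<p-1 , P∣i+1 =
      ℕₚ.<⇒≱ (m≤pred[n]⇒suc[m]≤n i<p-1)
        (ℕ.∣⇒≤ (∣⇒∣ᵤ (subst (P ∣_) (ℤₚ.+-identityʳ (+ suc i)) P∣i+1)))

    F : ℤ → ℤ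
    F = polyWithRoots nonzeroResidues

    F₀ : ℤ
    F₀ = F (+ 0)

    P∤F₀ : ¬ P ∣ F₀
    P∤F₀ P∣F₀ = ¬Any-nonzeroResidue-P∣ (P∣polyWithRoots⇒Any nonzeroResidues (+ 0) P∣F₀)

    multipleOfP : ℤ → ℤ
    multipleOfP t = indicator ⌊ P ∣? t ⌋

    F≡F₀*multipleOfP : ∀ t → F t ≡ F₀ * multipleOfP t [mod P ]
    F≡F₀*multipleOfP t with P ∣? t
    ... | yes P∣t = subst (λ u → F t ≡ u [mod P ]) (sym (ℤₚ.*-identityʳ F₀))
                      (polyWithRoots-cong-mod nonzeroResidues (∣⇒≡0-mod P∣t))
    ... | no P∤t = subst (λ u → F t ≡ u [mod P ]) (sym (ℤₚ.*-zeroʳ F₀))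
                     (∣⇒≡0-mod (Any⇒∣-polyWithRoots nonzeroResidues t (P∤⇒Any-nonzeroResidue t P∤t)))

    weight : ℕ → ℤ
    weight n = (δ n 0 - δ n p) + δ n (2 ℕ.* p)

    multiples-below-3p : ∀ {n} → n < 3 ℕ.* p → p ℕ∣ n → n ≡ 0 ⊎ n ≡ p ⊎ n ≡ 2 ℕ.* p
    multiples-below-3p n<3p (ℕ.divides zero n≡0) = inj₁ n≡0
    multiples-below-3p n<3p (ℕ.divides 1 n≡p) = inj₂ (inj₁ (trans n≡p (ℕₚ.+-identityʳ p)))
    multiples-below-3p n<3p (ℕ.divides 2 n≡2p) = inj₂ (inj₂ n≡2p)
    multiples-below-3p n<3p (ℕ.divides (suc (suc (suc q))) refl) =
      ⊥-elim (ℕₚ.<⇒≱ n<3p (ℕₚ.*-monoˡ-≤ p (s≤s (s≤s (s≤s (z≤n {q}))))))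

    sign-odd-prime : p ≢ 2 → sign p ≡ - + 1
    sign-odd-prime p≢2 with even⊎odd p
    ... | inj₂ (m , refl) = cong -_ (sign-double m)
    ... | inj₁ (m , p≡m+m) with prime⇒irreducible p-prime (ℕ.divides m p≡m*2)
      where
      p≡m*2 : p ≡ m ℕ.* 2
      p≡m*2 = trans p≡m+m (trans (cong (m ℕ.+_) (sym (ℕₚ.+-identityʳ m))) (ℕₚ.*-comm 2 m))
    ...   | inj₁ ()
    ...   | inj₂ 2≡p = ⊥-elim (p≢2 (sym 2≡p))

    p<2p : p < 2 ℕ.* p
    p<2p = ℕₚ.m<m+n p (ℕₚ.<-≤-trans (ℕ.>-nonZero⁻¹ p) (ℕₚ.≤-reflexive (sym (ℕₚ.+-identityʳ p))))

    0≢p : 0 ≢ p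
    0≢p = ≢-sym (ℕ.≢-nonZero⁻¹ p)

    0≢2p : 0 ≢ 2 ℕ.* p
    0≢2p = ℕₚ.<⇒≢ (ℕₚ.<-trans (ℕ.>-nonZero⁻¹ p) p<2p)

    weight-∤ : ∀ {n} → ¬ p ℕ∣ n → weight n ≡ + 0
    weight-∤ {n} p∤n = cong₂ _+_
      (cong₂ _-_ (δ-≢ n 0 (λ { refl → p∤n (ℕ.divides 0 refl) })) (δ-≢ n p (λ { refl → p∤n ℕ.∣-refl })))
      (δ-≢ n (2 ℕ.* p) (λ { refl → p∤n (ℕ.divides 2 refl) }))

    sign*multipleOfP≡weight : p ≢ 2 → ∀ n → n < 3 ℕ.* p → sign n * multipleOfP (+ n) ≡ weight n
    sign*multipleOfP≡weight p≢2 n n<3p with P ∣? + n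
    ... | no P∤n = trans (ℤₚ.*-zeroʳ (sign n)) (sym (weight-∤ (λ p∣n → P∤n (∣ᵤ⇒∣ p∣n))))
    ... | yes P∣n with multiples-below-3p n<3p (∣⇒∣ᵤ P∣n)
    ...   | inj₁ refl rewrite δ-≢ 0 p 0≢p | δ-≢ 0 (2 ℕ.* p) 0≢2p = refl
    ...   | inj₂ (inj₁ refl)
      rewrite δ-≢ p 0 (≢-sym 0≢p) | δ-refl p | δ-≢ p (2 ℕ.* p) (ℕₚ.<⇒≢ p<2p) | sign-odd-prime p≢2 = refl
    ...   | inj₂ (inj₂ refl)
      rewrite δ-≢ (2 ℕ.* p) 0 (≢-sym 0≢2p) | δ-≢ (2 ℕ.* p) p (≢-sym (ℕₚ.<⇒≢ p<2p)) | δ-refl (2 ℕ.* p) = sign-2p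
      where
      sign-2p : sign (2 ℕ.* p) * + 1 ≡ + 1
      sign-2p = trans (ℤₚ.*-identityʳ _) (trans (cong (λ k → sign (p ℕ.+ k)) (ℕₚ.+-identityʳ p)) (sign-double p))

    open FiniteDifferences _⊕_

    -- The leading + 1 is the constant (of degree < 1) from which G-degree builds the product.
    G : ℤ × Point → ℤ
    G (n , (a , b)) = ((+ 1 * F n) * F a) * F b

    G-degree : DegreeBelow (suc (3 ℕ.* ℕ.pred p)) G
    G-degree = subst (λ d → DegreeBelow d G) degree≡
      (DegreeBelow-*-polyWithRoots nonzeroResidues _ {λ u → (+ 1 * F (proj₁ u)) * F (proj₁ (proj₂ u))}
         (λ u → proj₂ (proj₂ u)) (λ _ _ → refl)
        (DegreeBelow-*-polyWithRoots nonzeroResidues _ {λ u → + 1 * F (proj₁ u)}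
           (λ u → proj₁ (proj₂ u)) (λ _ _ → refl)
          (DegreeBelow-*-polyWithRoots nonzeroResidues 1 {λ _ → + 1} proj₁ (λ _ _ → refl) (λ _ _ → refl))))
      where
      eq : ∀ n → n ℕ.+ (n ℕ.+ (n ℕ.+ 1)) ≡ suc (3 ℕ.* n)
      eq = ℕ-solve-∀
      degree≡ : length nonzeroResidues ℕ.+ (length nonzeroResidues ℕ.+ (length nonzeroResidues ℕ.+ 1))
              ≡ suc (3 ℕ.* ℕ.pred p)
      degree≡ rewrite length-applyUpTo (λ i → + suc i) (ℕ.pred p) = eq (ℕ.pred p)

    countTerm : List Point → ℤ
    countTerm S = weight (length S) * indicator (divPt p (sumPts S))

    sign*G∘σ≡F₀³*countTerm : p ≢ 2 → ∀ S → length S < 3 ℕ.* p →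
      sign (length S) * G (σ S) ≡ F₀ * (F₀ * (F₀ * countTerm S)) [mod P ]
    sign*G∘σ≡F₀³*countTerm p≢2 S ∣S∣<3p = begin
        sign n * (((+ 1 * F (+ n)) * F a) * F b)
      ≈⟨ *-cong-mod (≡⇒≡-mod {x = sign n} refl) (*-cong-mod (*-cong-mod (*-cong-mod (≡⇒≡-mod {x = + 1} refl)
           (F≡F₀*multipleOfP (+ n))) (F≡F₀*multipleOfP a)) (F≡F₀*multipleOfP b)) ⟩
        sign n * (((+ 1 * (F₀ * multipleOfP (+ n))) * (F₀ * multipleOfP a)) * (F₀ * multipleOfP b))
      ≡⟨ eq (sign n) F₀ (multipleOfP (+ n)) (multipleOfP a) (multipleOfP b) ⟩
        F₀ * (F₀ * (F₀ * ((sign n * multipleOfP (+ n)) * (multipleOfP a * multipleOfP b))))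
      ≡⟨ cong (λ w → F₀ * (F₀ * (F₀ * w)))
           (cong₂ _*_ (sign*multipleOfP≡weight p≢2 n ∣S∣<3p) (sym (indicator-∧ ⌊ P ∣? a ⌋ ⌊ P ∣? b ⌋))) ⟩
        F₀ * (F₀ * (F₀ * countTerm S)) ∎
      where
      open SetoidReasoning (mod-setoid P)
      n : ℕ
      n = length S
      a b : ℤ
      a = proj₁ (sumPts S)
      b = proj₂ (sumPts S)
      eq : ∀ s w x y z → s * (((+ 1 * (w * x)) * (w * y)) * (w * z)) ≡ w * (w * (w * ((s * x) * (y * z))))
      eq = solve-∀

    counted : ℕ → List Point → ℤ
    counted k S = indicator (⌊ length S ℕ.≟ k ⌋ ∧ divPt p (sumPts S))

    countTerm≡ : ∀ S → countTerm S ≡ (counted 0 S - counted p S) + counted (2 ℕ.* p) S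
    countTerm≡ S
      rewrite indicator-∧ ⌊ length S ℕ.≟ 0 ⌋ (divPt p (sumPts S))
            | indicator-∧ ⌊ length S ℕ.≟ p ⌋ (divPt p (sumPts S))
            | indicator-∧ ⌊ length S ℕ.≟ 2 ℕ.* p ⌋ (divPt p (sumPts S)) =
      eq (δ (length S) 0) (δ (length S) p) (δ (length S) (2 ℕ.* p)) (indicator (divPt p (sumPts S)))
      where
      eq : ∀ a b c x → ((a - b) + c) * x ≡ (a * x - b * x) + c * x
      eq = solve-∀

    sumSublists-countTerm : ∀ xs → sumSublists xs countTerm ≡ (+ 1 - + nsub p p xs) + + nsub p (2 ℕ.* p) xs
    sumSublists-countTerm xs = begin
        sumSublists xs countTerm
      ≡⟨ sumSublists-cong xs countTerm≡ ⟩
        sumSublists xs (λ S → (counted 0 S - counted p S) + counted (2 ℕ.* p) S)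
      ≡⟨ sumSublists-+ xs _ (counted (2 ℕ.* p)) ⟩
        sumSublists xs (λ S → counted 0 S - counted p S) + sumSublists xs (counted (2 ℕ.* p))
      ≡⟨ cong (_+ sumSublists xs (counted (2 ℕ.* p)))
           (trans (sumSublists-+ xs (counted 0) _)
             (cong (λ w → sumSublists xs (counted 0) + w) (sumSublists-neg xs (counted p)))) ⟩
        (sumSublists xs (counted 0) - sumSublists xs (counted p)) + sumSublists xs (counted (2 ℕ.* p))
      ≡⟨ cong₂ _+_ (cong₂ _-_ (count≡nsub 0) (count≡nsub p)) (count≡nsub (2 ℕ.* p)) ⟩
        (+ nsub p 0 xs - + nsub p p xs) + + nsub p (2 ℕ.* p) xs
      ≡⟨ cong (λ c → (+ c - + nsub p p xs) + + nsub p (2 ℕ.* p) xs) (nsub-zero p xs) ⟩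
        (+ 1 - + nsub p p xs) + + nsub p (2 ℕ.* p) xs ∎
      where
      open ≡-Reasoning
      count≡nsub : ∀ k → sumSublists xs (counted k) ≡ + nsub p k xs
      count≡nsub k = sumSublists-count (λ S → ⌊ length S ℕ.≟ k ⌋ ∧ divPt p (sumPts S)) xs

    P∣1-nsub[p]+nsub[2p] : p ≢ 2 → ∀ J → 3 ℕ.* ℕ.pred p < length J → length J < 3 ℕ.* p →
      P ∣ (+ 1 - + nsub p p J) + + nsub p (2 ℕ.* p) J
    P∣1-nsub[p]+nsub[2p] p≢2 J degG<∣J∣ ∣J∣<3p =
      P∣*-cancelˡ P∤F₀ (P∣*-cancelˡ P∤F₀ (P∣*-cancelˡ P∤F₀ (≡0-mod⇒∣ (mod-sym congruence))))
      where
      open SetoidReasoning (mod-setoid P)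
      congruence : + 0 ≡ F₀ * (F₀ * (F₀ * ((+ 1 - + nsub p p J) + + nsub p (2 ℕ.* p) J))) [mod P ]
      congruence = begin
          + 0
        ≡⟨ sym (alternatingSum-vanishes (+ 1 ,_) {σ} σ-∷ _ J {G} G-degree degG<∣J∣) ⟩
          alternatingSum (+ 1 ,_) {σ} σ-∷ G J
        ≈⟨ sumSublists-cong-mod J (λ S ∣S∣≤∣J∣ →
             sign*G∘σ≡F₀³*countTerm p≢2 S (ℕₚ.≤-<-trans ∣S∣≤∣J∣ ∣J∣<3p)) ⟩
          sumSublists J (λ S → F₀ * (F₀ * (F₀ * countTerm S)))
        ≡⟨ trans (sumSublists-*ˡ J F₀ _) (cong (F₀ *_) (trans (sumSublists-*ˡ J F₀ _) (cong (F₀ *_)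
             (sumSublists-*ˡ J F₀ countTerm)))) ⟩
          F₀ * (F₀ * (F₀ * sumSublists J countTerm))
        ≡⟨ cong (λ w → F₀ * (F₀ * (F₀ * w))) (sumSublists-countTerm J) ⟩
          F₀ * (F₀ * (F₀ * ((+ 1 - + nsub p p J) + + nsub p (2 ℕ.* p) J))) ∎


  length-bounds : ∀ q {n} → n ≡ 3 ℕ.* suc (suc q) ℕ.∸ 2 ⊎ n ≡ 3 ℕ.* suc (suc q) ℕ.∸ 1 →
    3 ℕ.* suc q < n × n < 3 ℕ.* suc (suc q)
  length-bounds q (inj₁ refl) = ℕₚ.≤-reflexive (eq q) , ℕₚ.m<n⇒m<1+n (ℕₚ.n<1+n _)
    where
    eq : ∀ q → suc (3 ℕ.* suc q) ≡ q ℕ.+ (suc (suc q) ℕ.+ (suc (suc q) ℕ.+ 0))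
    eq = ℕ-solve-∀
  length-bounds q (inj₂ refl) = ℕₚ.m≤n⇒m≤1+n (proj₁ (length-bounds q (inj₁ refl))) , ℕₚ.n<1+n _


open import Data.Empty using (⊥-elim)
open import Data.Integer using (+_; _+_; _-_)
open import Data.Integer.Divisibility using (_∣_)
open import Data.Integer.Divisibility.Signed using (∣⇒∣ᵤ)
open import Data.List using (List; length)
open import Data.List.Relation.Unary.Unique.Propositional using (Unique)
open import Data.Nat using (ℕ; zero; suc; _*_; _∸_)
open import Data.Nat.Primality using (Prime; ¬prime[0]; ¬prime[1])
open import Data.Product using (_,_)
open import Data.Sum using (_⊎_)
open import Relation.Binary.PropositionalEquality using (_≡_; _≢_)
open PolynomialMethod using (length-bounds)
open PolynomialMethod.ModuloPrime using (P∣1-nsub[p]+nsub[2p])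

corollary2 : (p : ℕ) → Prime p → p ≢ 2 → (J : List Point) → Unique J →
    (length J ≡ 3 * p ∸ 2 ⊎ length J ≡ 3 * p ∸ 1) →
    (+ p) ∣ ((+ 1 - + nsub p p J) + + nsub p (2 * p) J)
corollary2 zero p-prime = ⊥-elim (¬prime[0] p-prime)
corollary2 (suc zero) p-prime = ⊥-elim (¬prime[1] p-prime)
corollary2 p@(suc (suc q)) p-prime p≢2 J _ ∣J∣≡ with length-bounds q ∣J∣≡
... | lower , upper = ∣⇒∣ᵤ (P∣1-nsub[p]+nsub[2p] p p-prime p≢2 J lower upper)
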